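{- Let $G$ be a graph with property $(*)$ and let $M$ be a perfect matching of $G$. If $C,C'$ are two saturated chains in the dimer lattice from $\hat0$ to $M$, then $\mathrm{wt}(C)=\mathrm{wt}(C')$.
   Context: Property $(*)$: $G$ is a finite connected bipartite plane graph with fixed proper black/white coloring and every edge lies in some perfect matching. For a bounded face $f$, an edge of $f$ is black-white if going clockwise around $f$ one meets its black endpoint first, white-black otherwise. If a perfect matching $M$ contains all black-white edges of $f$, the down-flip at $f$ replaces them by the white-black edges of $f$ (inverse: up-flip); two matchings are related by a flip at $f$ if one is obtained from the other by an up- or down-flip at $f$. The dimer lattice is the set of perfect matchings with $M\le M'$ iff $M$ is obtained from $M'$ by a sequence of down-flips; it is a distributive lattice with minimum $\hat0$. For a saturated chain $C:\hat0=M_0\lessdot M_1\lessdot\cdots\lessdot M_\ell$ where $M_{i-1},M_i$ are related by a flip at face $f_i$, its weight is $\mathrm{wt}(C)=y_{f_1}\cdots y_{f_\ell}$. -}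

module Defs where

open import Data.Nat using (ℕ; zero; suc; _+_; _*_; _≤ᵇ_)
open import Data.Bool using (Bool; true; false; T; not; _∧_)
open import Data.Fin using (Fin; toℕ)
open import Data.Fin.Subset using (Subset; _∈_)
open import Data.List using (List; []; _∷_; length; filterᵇ; allFin; upTo)
open import Data.Product using (Σ; ∃; _×_; _,_)
open import Data.Sum using (_⊎_)
open import Data.Empty using (⊥)
open import Relation.Nullary using (¬_)
open import Relation.Binary.PropositionalEquality using (_≡_; _≢_)
open import Relation.Binary.Construct.Closure.ReflexiveTransitive using (Star)
open import Function.Bundles using (_⇔_)

iter : {A : Set} → (A → A) → ℕ → A → A
iter f zero    x = x
iter f (suc k) x = f (iter f k x)

allᵇ : {A : Set} → (A → Bool) → List A → Bool
allᵇ p []       = true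
allᵇ p (x ∷ xs) = p x ∧ allᵇ p xs

SameOrbit : {A : Set} → (A → A) → A → A → Set
SameOrbit f d e = ∃ λ k → iter f k d ≡ e

-- d is the (toℕ-)smallest element of its orbit under a permutation f of Fin n
-- (for a permutation of Fin n the orbit of d is {f^k d | k < n}).
isOrbitRep : {n : ℕ} → (Fin n → Fin n) → Fin n → Bool
isOrbitRep {n} f d = allᵇ (λ k → toℕ d ≤ᵇ toℕ (iter f k d)) (upTo n)

numOrbits : {n : ℕ} → (Fin n → Fin n) → ℕ
numOrbits {n} f = length (filterᵇ (isOrbitRep f) (allFin n))

-- A finite connected bipartite plane graph with a fixed proper
-- black/white colouring, encoded as a combinatorial map (rotation
-- system) of genus 0 together with a choice of the outer face.
--
--  * darts (half-edges) : Fin n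
--  * α : the involution exchanging the two darts of an edge
--  * σ : rotation around vertices (counterclockwise); vertices = σ-orbits
--  * φ = σ ∘ α : face permutation; faces = φ-orbits.  With σ
--    counterclockwise, a φ-orbit traverses its face with the face on
--    the right, i.e. bounded faces are traversed CLOCKWISE; a dart d in
--    the φ-orbit of a face f traverses an edge of f from the vertex of d
--    to the vertex of α d.
--  * outer : a dart of the unbounded face
--  * colour : colour (true = black) of the vertex at which a dart starts
record BipartitePlaneGraph : Set where
  field
    n       : ℕ
    α       : Fin n → Fin n
    σ       : Fin n → Fin n
    σ⁻¹     : Fin n → Fin n
    α-invol : ∀ d → α (α d) ≡ d
    α-fpf   : ∀ d → α d ≢ d
    σσ⁻¹    : ∀ d → σ (σ⁻¹ d) ≡ d
    σ⁻¹σ    : ∀ d → σ⁻¹ (σ d) ≡ d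
    connected : ∀ d e → Star (λ x y → (y ≡ σ x) ⊎ (y ≡ α x)) d e
    -- no multiple edges: two edges with the same endpoints coincide
    simple  : ∀ d e → SameOrbit σ d e → SameOrbit σ (α d) (α e) → d ≡ e
    outer   : Fin n
    -- genus 0 (Euler's formula V - E + F = 2 with E = n/2)
    euler   : 2 * numOrbits σ + 2 * numOrbits (λ d → σ (α d)) ≡ n + 4
    colour        : Fin n → Bool
    colour-vertex : ∀ d → colour (σ d) ≡ colour d
    colour-proper : ∀ d → colour (α d) ≢ colour d

module _ (G : BipartitePlaneGraph) where
  open BipartitePlaneGraph G

  φ : Fin n → Fin n
  φ d = σ (α d)

  BoundedFace : Fin n → Set
  BoundedFace f = T (isOrbitRep φ f) × ¬ SameOrbit φ outer f

  -- perfect matchings, as α-closed sets of darts meeting every vertex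
  -- (σ-orbit) in exactly one dart
  record PerfectMatching (M : Subset n) : Set where
    field
      α-closed : ∀ d → d ∈ M → α d ∈ M
      covers   : ∀ d → ∃ λ k → iter σ k d ∈ M
      unique   : ∀ d k → d ∈ M → iter σ k d ∈ M → iter σ k d ≡ d

  -- Property (*) (beyond the structure above): every edge lies in a
  -- perfect matching
  EveryEdgeMatchable : Set
  EveryEdgeMatchable = ∀ d → ∃ λ M → PerfectMatching M × d ∈ M

  InBW : Fin n → Fin n → Set
  InBW f e = ∃ λ d → SameOrbit φ f d × colour d ≡ true × ((e ≡ d) ⊎ (e ≡ α d))

  InWB : Fin n → Fin n → Set
  InWB f e = ∃ λ d → SameOrbit φ f d × colour d ≡ false × ((e ≡ d) ⊎ (e ≡ α d))

  DownFlip : Fin n → Subset n → Subset n → Set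
  DownFlip f M M' =
    (∀ d → SameOrbit φ f d → colour d ≡ true → d ∈ M) ×
    (∀ e → (e ∈ M') ⇔ (((e ∈ M) × ¬ InBW f e) ⊎ InWB f e))

  FlipAt : Fin n → Subset n → Subset n → Set
  FlipAt f M M' = BoundedFace f × (DownFlip f M M' ⊎ DownFlip f M' M)

  DownStep : Subset n → Subset n → Set
  DownStep M' M = PerfectMatching M' × PerfectMatching M ×
                  (∃ λ f → BoundedFace f × DownFlip f M' M)

  _≤D_ : Subset n → Subset n → Set
  M ≤D M' = Star DownStep M' M

  _⋖D_ : Subset n → Subset n → Set
  M ⋖D M' = M ≤D M' × M ≢ M' ×
            (∀ N → PerfectMatching N → M ≤D N → N ≤D M' → (N ≡ M) ⊎ (N ≡ M'))

  IsBottom : Subset n → Set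
  IsBottom Z = PerfectMatching Z × (∀ N → PerfectMatching N → Z ≤D N)

  -- saturated chains M₀ ⋖ M₁ ⋖ ... ⋖ M_ℓ, each step labelled by a face
  -- f_i at which M_{i-1}, M_i are related by a flip; the index list
  -- [f_1, ..., f_ℓ] (canonical face representatives) encodes the weight
  -- monomial y_{f_1} ⋯ y_{f_ℓ}.
  data SatChain : Subset n → Subset n → List (Fin n) → Set where
    done : ∀ {M} → SatChain M M []
    step : ∀ {M₀ M₁ M fs} f → M₀ ⋖D M₁ → FlipAt f M₀ M₁ →
           SatChain M₁ M fs → SatChain M₀ M (f ∷ fs)

{-# OPTIONS --safe #-}

-- A down-flip at f changes a matching only along the boundary of f: for a black dart d,
-- [d ∈ A] − [d ∈ B] = [d ∈ f] − [α d ∈ f].  Summed along a chain, the change of the matching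
-- across each edge is the jump, across that edge, of the function counting how often each face
-- was flipped.  For two chains with the same endpoints the difference of these flip counts is
-- therefore invariant under α and under φ, hence under σ = φα; by connectedness it is constant,
-- and it vanishes because the outer face is never flipped.  Equal flip counts are equal weights.
-- The same argument rules out cycles of down-flips, which is why every covering step of a
-- saturated chain is a down-flip from the larger matching.

module Submission where

open import Defs
open import Data.Fin.Subset using (Subset)
open import Data.List using (List)
open import Data.Fin using (Fin)
open import Data.List.Relation.Binary.Permutation.Propositional using (_↭_)

open import Algebra.Properties.CommutativeSemigroup using (x∙yz≈y∙xz)
open import Data.Bool using (Bool; true; false; not; T)
open import Data.Bool.Properties using (T-∧)
open import Data.Fin using (toℕ; fromℕ<)
open import Data.Fin.Properties using (_≟_; any?; pigeonhole; toℕ-fromℕ<; toℕ-injective; toℕ≤pred[n])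
open import Data.Fin.Subset using (_∈_; _∉_)
open import Data.Fin.Subset.Properties using (_∈?_)
open import Data.Integer as ℤ using (ℤ; +_; _-_)
open import Data.Integer.Properties using (pos-+; +-injective; +-inverseʳ; i≡j⇒i-j≡0; i-j≡0⇒i≡j)
open import Data.Integer.Tactic.RingSolver using (solve-∀)
open import Data.List using ([]; _∷_; _++_; upTo)
open import Data.List.Membership.Propositional.Properties using (∈-∃++; ∈-upTo⁺)
open import Data.List.Relation.Binary.Permutation.Propositional using (↭-refl; ↭-sym; ↭-trans; prep)
open import Data.List.Relation.Binary.Permutation.Propositional.Properties using (shift)
open import Data.List.Relation.Unary.All as All using (All; []; _∷_)
open import Data.List.Relation.Unary.Any using (Any; here; there)
open import Data.Nat using (ℕ; zero; suc; _+_; _*_; _≤_; _<_; _≤ᵇ_)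
open import Data.Nat.DivMod using (_%_; _/_; m≡m%n+[m/n]*n; m%n<n)
open import Data.Nat.Properties
  using ( +-comm; +-suc; *-suc; +-cancelˡ-≡; 1+n≢0; ≤-trans; ≤-antisym; m≤n+m; n<1+n; ≤ᵇ⇒≤; m≤n⇒∃[o]m+o≡n
        ; +-commutativeSemigroup)
open import Data.Product using (∃; _×_; _,_; proj₁; proj₂)
open import Data.Sum using (_⊎_; inj₁; inj₂)
open import Function using (_∘_; _⇔_; mk⇔; Equivalence)
open import Relation.Binary.Construct.Closure.ReflexiveTransitive using (Star; ε; _◅_; _◅◅_)
open import Relation.Binary.Definitions using (DecidableEquality)
open import Relation.Binary.PropositionalEquality
  using (_≡_; _≢_; refl; sym; trans; cong; cong₂; subst; module ≡-Reasoning)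
open import Relation.Nullary using (¬_; Dec; yes; no; contradiction)
open import Relation.Nullary.Decidable using (map′; T?)
open import Relation.Unary using (Pred; Decidable)

open ≡-Reasoning

𝟙 : ∀ {p} {P : Set p} → Dec P → ℕ
𝟙 (yes _) = 1
𝟙 (no _)  = 0

𝟙-yes : ∀ {p} {P : Set p} (P? : Dec P) → P → 𝟙 P? ≡ 1
𝟙-yes (yes _) _ = refl
𝟙-yes (no ¬p) p = contradiction p ¬p

𝟙-no : ∀ {p} {P : Set p} (P? : Dec P) → ¬ P → 𝟙 P? ≡ 0
𝟙-no (yes p) ¬p = contradiction p ¬p
𝟙-no (no _)  _  = refl

𝟙-cong : ∀ {p q} {P : Set p} {Q : Set q} → P ⇔ Q → (P? : Dec P) (Q? : Dec Q) → 𝟙 P? ≡ 𝟙 Q?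
𝟙-cong P⇔Q (yes p) Q? = sym (𝟙-yes Q? (Equivalence.to P⇔Q p))
𝟙-cong P⇔Q (no ¬p) Q? = sym (𝟙-no Q? (¬p ∘ Equivalence.from P⇔Q))

module _ {a} {A : Set a} where

  count : ∀ {p} {P : Pred A p} → Decidable P → List A → ℕ
  count P? []       = 0
  count P? (x ∷ xs) = 𝟙 (P? x) + count P? xs

  count-cong : ∀ {p q} {P : Pred A p} {Q : Pred A q} (P? : Decidable P) (Q? : Decidable Q) {xs} →
               All (λ x → P x ⇔ Q x) xs → count P? xs ≡ count Q? xs
  count-cong P? Q? []                     = refl
  count-cong P? Q? {x ∷ _} (P⇔Q ∷ P⇔Qs) = cong₂ _+_ (𝟙-cong P⇔Q (P? x) (Q? x)) (count-cong P? Q? P⇔Qs)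

  count-none : ∀ {p} {P : Pred A p} (P? : Decidable P) {xs : List A} → All (¬_ ∘ P) xs → count P? xs ≡ 0
  count-none P? []                  = refl
  count-none P? {x ∷ _} (¬px ∷ ¬ps) = cong₂ _+_ (𝟙-no (P? x) ¬px) (count-none P? ¬ps)

  count-∷≢0 : ∀ {p} {P : Pred A p} (P? : Decidable P) {x xs} → P x → count P? (x ∷ xs) ≢ 0
  count-∷≢0 P? {x} px with P? x
  ... | yes _  = 1+n≢0
  ... | no ¬px = contradiction px ¬px

  count≢0⇒Any : ∀ {p} {P : Pred A p} (P? : Decidable P) (xs : List A) → count P? xs ≢ 0 → Any P xs
  count≢0⇒Any P? []       c≢0 = contradiction refl c≢0
  count≢0⇒Any P? (x ∷ xs) c≢0 with P? x
  ... | yes px = here px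
  ... | no _   = there (count≢0⇒Any P? xs c≢0)

  count-shift : ∀ {p} {P : Pred A p} (P? : Decidable P) (y : A) (us vs : List A) →
                count P? (us ++ y ∷ vs) ≡ 𝟙 (P? y) + count P? (us ++ vs)
  count-shift P? y []       vs = refl
  count-shift P? y (u ∷ us) vs = begin
    𝟙 (P? u) + count P? (us ++ y ∷ vs)
      ≡⟨ cong (λ c → 𝟙 (P? u) + c) (count-shift P? y us vs) ⟩
    𝟙 (P? u) + (𝟙 (P? y) + count P? (us ++ vs))
      ≡⟨ x∙yz≈y∙xz +-commutativeSemigroup (𝟙 (P? u)) (𝟙 (P? y)) _ ⟩
    𝟙 (P? y) + (𝟙 (P? u) + count P? (us ++ vs))
      ∎

module _ {a} {A : Set a} (_≟ᴬ_ : DecidableEquality A) where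

  count-≡⇒↭ : (xs ys : List A) → (∀ x → count (x ≟ᴬ_) xs ≡ count (x ≟ᴬ_) ys) → xs ↭ ys
  count-≡⇒↭ [] []       _    = ↭-refl
  count-≡⇒↭ [] (y ∷ ys) same = contradiction (sym (same y)) (count-∷≢0 (y ≟ᴬ_) {xs = ys} refl)
  count-≡⇒↭ (x ∷ xs) ys same
    with us , vs , refl ← ∈-∃++ (count≢0⇒Any (x ≟ᴬ_) ys
                                   (count-∷≢0 (x ≟ᴬ_) {xs = xs} refl ∘ trans (same x)))
    = ↭-trans (prep x (count-≡⇒↭ xs (us ++ vs) same-rest)) (↭-sym (shift x us vs))
    where
    same-rest : ∀ z → count (z ≟ᴬ_) xs ≡ count (z ≟ᴬ_) (us ++ vs)
    same-rest z = +-cancelˡ-≡ (𝟙 (z ≟ᴬ x)) _ _ (trans (same z) (count-shift (z ≟ᴬ_) x us vs))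

module _ {A : Set} (g : A → A) where

  iter-+ : ∀ m k x → iter g (m + k) x ≡ iter g m (iter g k x)
  iter-+ zero    k x = refl
  iter-+ (suc m) k x = cong g (iter-+ m k x)

  iter-commute : ∀ m x → iter g m (g x) ≡ g (iter g m x)
  iter-commute zero    x = refl
  iter-commute (suc m) x = cong g (iter-commute m x)

  iter-*-fix : ∀ q {x} → iter g q x ≡ x → ∀ m → iter g (m * q) x ≡ x
  iter-*-fix q     fix zero    = refl
  iter-*-fix q {x} fix (suc m) = begin
    iter g (q + m * q) x          ≡⟨ iter-+ q (m * q) x ⟩
    iter g q (iter g (m * q) x)   ≡⟨ cong (iter g q) (iter-*-fix q fix m) ⟩
    iter g q x                    ≡⟨ fix ⟩
    x                             ∎

allᵇ⇒All : ∀ {A : Set} (p : A → Bool) xs → T (allᵇ p xs) → All (T ∘ p) xs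
allᵇ⇒All p []       _ = []
allᵇ⇒All p (x ∷ xs) t = proj₁ (Equivalence.to T-∧ t) ∷ allᵇ⇒All p xs (proj₂ (Equivalence.to T-∧ t))

module Orbits {n : ℕ} (g : Fin n → Fin n) (g-injective : ∀ {x y} → g x ≡ g y → x ≡ y) where

  iter-injective : ∀ k {x y} → iter g k x ≡ iter g k y → x ≡ y
  iter-injective zero    eq = eq
  iter-injective (suc k) eq = iter-injective k (g-injective eq)

  -- Pigeonhole on x, g x, …, gⁿ x gives gⁱ x ≡ gⁱ⁺¹⁺ᵖ x; cancel gⁱ.
  period : ∀ x → ∃ λ p → p < n × iter g (suc p) x ≡ x
  period x with i , j , i<j , gⁱx≡gʲx ← pigeonhole (n<1+n n) (λ (k : Fin (suc n)) → iter g (toℕ k) x)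
             with p , 1+i+p≡j ← m≤n⇒∃[o]m+o≡n i<j = p , p<n , iter-injective (toℕ i) (begin
    iter g (toℕ i) (iter g (suc p) x) ≡⟨ iter-+ g (toℕ i) (suc p) x ⟨
    iter g (toℕ i + suc p) x          ≡⟨ cong (λ k → iter g k x) i+1+p≡j ⟩
    iter g (toℕ j) x                  ≡⟨ gⁱx≡gʲx ⟨
    iter g (toℕ i) x                  ∎)
    where
    i+1+p≡j : toℕ i + suc p ≡ toℕ j
    i+1+p≡j = trans (+-suc (toℕ i) p) 1+i+p≡j
    p<n : p < n
    p<n = ≤-trans (subst (suc p ≤_) i+1+p≡j (m≤n+m (suc p) (toℕ i))) (toℕ≤pred[n] j)

  iter-reduce : ∀ x k → ∃ λ j → j < n × iter g j x ≡ iter g k x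
  iter-reduce x k with p , p<n , gᵖ⁺¹x≡x ← period x =
    k % suc p , ≤-trans (m%n<n k (suc p)) p<n , sym (begin
      iter g k x
        ≡⟨ cong (λ m → iter g m x) (m≡m%n+[m/n]*n k (suc p)) ⟩
      iter g (k % suc p + k / suc p * suc p) x
        ≡⟨ iter-+ g (k % suc p) _ x ⟩
      iter g (k % suc p) (iter g (k / suc p * suc p) x)
        ≡⟨ cong (iter g (k % suc p)) (iter-*-fix g (suc p) gᵖ⁺¹x≡x (k / suc p)) ⟩
      iter g (k % suc p) x
        ∎)

  sameOrbit? : ∀ x y → Dec (SameOrbit g x y)
  sameOrbit? x y = map′ (λ (k , gᵏx≡y) → toℕ k , gᵏx≡y) within-n (any? λ k → iter g (toℕ k) x ≟ y)
    where
    within-n : SameOrbit g x y → ∃ λ (k : Fin n) → iter g (toℕ k) x ≡ y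
    within-n (k , gᵏx≡y) with j , j<n , gʲx≡gᵏx ← iter-reduce x k =
      fromℕ< j<n , trans (cong (λ m → iter g m x) (toℕ-fromℕ< j<n)) (trans gʲx≡gᵏx gᵏx≡y)

  sameOrbit-sym : ∀ {x y} → SameOrbit g x y → SameOrbit g y x
  sameOrbit-sym {x} (k , refl) with p , _ , gᵖ⁺¹x≡x ← period x = k * p , (begin
    iter g (k * p) (iter g k x) ≡⟨ iter-+ g (k * p) k x ⟨
    iter g (k * p + k) x        ≡⟨ cong (λ m → iter g m x) (trans (+-comm (k * p) k) (sym (*-suc k p))) ⟩
    iter g (k * suc p) x        ≡⟨ iter-*-fix g (suc p) gᵖ⁺¹x≡x k ⟩
    x                           ∎)

  sameOrbit-step : ∀ {x y} → SameOrbit g x y → SameOrbit g x (g y)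
  sameOrbit-step (k , gᵏx≡y) = suc k , cong g gᵏx≡y

  sameOrbit-unstep : ∀ {x y} → SameOrbit g x (g y) → SameOrbit g x y
  sameOrbit-unstep {y = y} x∼gy with k , gᵏgy≡x ← sameOrbit-sym x∼gy =
    sameOrbit-sym (suc k , trans (sym (iter-commute g k y)) gᵏgy≡x)

  orbitRep-minimal : ∀ {d x} → T (isOrbitRep g d) → SameOrbit g d x → toℕ d ≤ toℕ x
  orbitRep-minimal {d} rep (k , gᵏd≡x) with j , j<n , gʲd≡gᵏd ← iter-reduce d k =
    subst (λ y → toℕ d ≤ toℕ y) (trans gʲd≡gᵏd gᵏd≡x)
      (≤ᵇ⇒≤ (toℕ d) _
        (All.lookup (allᵇ⇒All (λ k → toℕ d ≤ᵇ toℕ (iter g k d)) (upTo n) rep) (∈-upTo⁺ j<n)))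

  orbitRep-unique : ∀ {d e} → T (isOrbitRep g d) → T (isOrbitRep g e) → SameOrbit g d e → d ≡ e
  orbitRep-unique d-rep e-rep d∼e =
    toℕ-injective (≤-antisym (orbitRep-minimal d-rep d∼e) (orbitRep-minimal e-rep (sameOrbit-sym d∼e)))

a-c≡[a-b]+[b-c] : ∀ a b c → a - c ≡ (a - b) ℤ.+ (b - c)
a-c≡[a-b]+[b-c] = solve-∀

[a+b]-[c+d]≡[a-c]+[b-d] : ∀ a b c d → (a ℤ.+ b) - (c ℤ.+ d) ≡ (a - c) ℤ.+ (b - d)
[a+b]-[c+d]≡[a-c]+[b-d] = solve-∀

[a-b]-[c-d]≡[a-c]-[b-d] : ∀ a b c d → (a - b) - (c - d) ≡ (a - c) - (b - d)
[a-b]-[c-d]≡[a-c]-[b-d] = solve-∀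

diff-cong : ∀ {a b c d : ℕ} → a ≡ c → b ≡ d → + a - + b ≡ + c - + d
diff-cong = cong₂ (λ a b → + a - + b)

module FlipCounts (G : BipartitePlaneGraph) where
  open BipartitePlaneGraph G

  α-injective : ∀ {x y} → α x ≡ α y → x ≡ y
  α-injective {x} {y} eq = trans (sym (α-invol x)) (trans (cong α eq) (α-invol y))

  φ-injective : ∀ {x y} → φ G x ≡ φ G y → x ≡ y
  φ-injective {x} {y} eq = α-injective (trans (sym (σ⁻¹σ (α x))) (trans (cong σ⁻¹ eq) (σ⁻¹σ (α y))))

  open Orbits (φ G) φ-injective

  colour-α : ∀ d → colour (α d) ≡ not (colour d)
  colour-α d with colour d | colour (α d) | colour-proper d
  ... | true  | true  | c≢c = contradiction refl c≢c
  ... | true  | false | _   = refl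
  ... | false | true  | _   = refl
  ... | false | false | c≢c = contradiction refl c≢c

  black-α-white : ∀ {d} → colour d ≡ true → colour (α d) ≡ false
  black-α-white {d} d-black = trans (colour-α d) (cong not d-black)

  inBW⇒onFace : ∀ {f d} → colour d ≡ true → InBW G f d → SameOrbit (φ G) f d
  inBW⇒onFace _       (_ , d′∈f , _ , inj₁ refl) = d′∈f
  inBW⇒onFace d-black (d′ , _ , d′-black , inj₂ refl) =
    contradiction (trans (sym (black-α-white d′-black)) d-black) λ ()

  inWB⇔α-onFace : ∀ {f d} → colour d ≡ true → InWB G f d ⇔ SameOrbit (φ G) f (α d)
  inWB⇔α-onFace {f} {d} d-black =
    mk⇔ to (λ αd∈f → α d , αd∈f , black-α-white d-black , inj₂ (sym (α-invol d)))
    where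
    to : InWB G f d → SameOrbit (φ G) f (α d)
    to (_ , _ , d′-white , inj₁ refl) = contradiction (trans (sym d-black) d′-white) λ ()
    to (d′ , d′∈f , _ , inj₂ refl) = subst (SameOrbit (φ G) f) (sym (α-invol d′)) d′∈f

  onFace : Fin n → Fin n → ℕ
  onFace f x = 𝟙 (sameOrbit? f x)

  -- Read h d as a height on the face to the right of dart d.  Flux h A B says that across
  -- every edge {d, α d} (d black) the change from A to B is the jump of h across the edge.
  Flux : (Fin n → ℕ) → Subset n → Subset n → Set
  Flux h A B = ∀ d → colour d ≡ true → + 𝟙 (d ∈? A) - + 𝟙 (d ∈? B) ≡ + h d - + h (α d)

  module _ {f : Fin n} {A B : Subset n} (A-perfect : PerfectMatching G A) (flip : DownFlip G f A B)
           {d : Fin n} (d-black : colour d ≡ true) where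

    private
      _∈f : Fin n → Set
      e ∈f = SameOrbit (φ G) f e

    α∈f⇒∈B : α d ∈f → d ∈ B
    α∈f⇒∈B αd∈f =
      Equivalence.from (proj₂ flip d) (inj₂ (Equivalence.from (inWB⇔α-onFace d-black) αd∈f))

    ∈A⇒∈B : ¬ d ∈f → d ∈ A → d ∈ B
    ∈A⇒∈B d∉f d∈A = Equivalence.from (proj₂ flip d) (inj₁ (d∈A , d∉f ∘ inBW⇒onFace d-black))

    ∈B⇒∈A∉f : ¬ α d ∈f → d ∈ B → d ∈ A × ¬ d ∈f
    ∈B⇒∈A∉f αd∉f d∈B with Equivalence.to (proj₂ flip d) d∈B
    ... | inj₁ (d∈A , d∉BW) = d∈A , λ d∈f → d∉BW (d , d∈f , d-black , inj₁ refl)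
    ... | inj₂ d∈WB         = contradiction (Equivalence.to (inWB⇔α-onFace d-black) d∈WB) αd∉f

    -- If α d ∈ f then σ d = φ (α d) is a black dart of f, hence matched in A; so d is not.
    α∈f⇒∉A : ¬ d ∈f → α d ∈f → d ∉ A
    α∈f⇒∉A d∉f αd∈f d∈A = d∉f (subst _∈f (PerfectMatching.unique A-perfect d 1 d∈A σd∈A) σd∈f)
      where
      σd∈f : σ d ∈f
      σd∈f = subst (λ e → σ e ∈f) (α-invol d) (sameOrbit-step αd∈f)
      σd∈A : σ d ∈ A
      σd∈A = proj₁ flip (σ d) σd∈f (trans (colour-vertex d) d-black)

    downFlip-flux-at : + 𝟙 (d ∈? A) - + 𝟙 (d ∈? B) ≡ + onFace f d - + onFace f (α d)
    downFlip-flux-at with sameOrbit? f d | sameOrbit? f (α d)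
    ... | yes d∈f | yes αd∈f =
      diff-cong (𝟙-yes (d ∈? A) (proj₁ flip d d∈f d-black)) (𝟙-yes (d ∈? B) (α∈f⇒∈B αd∈f))
    ... | yes d∈f | no αd∉f  =
      diff-cong (𝟙-yes (d ∈? A) (proj₁ flip d d∈f d-black))
                (𝟙-no (d ∈? B) λ d∈B → proj₂ (∈B⇒∈A∉f αd∉f d∈B) d∈f)
    ... | no d∉f  | yes αd∈f =
      diff-cong (𝟙-no (d ∈? A) (α∈f⇒∉A d∉f αd∈f)) (𝟙-yes (d ∈? B) (α∈f⇒∈B αd∈f))
    ... | no d∉f  | no αd∉f  =
      i≡j⇒i-j≡0 (cong +_ (𝟙-cong (mk⇔ (∈A⇒∈B d∉f) (proj₁ ∘ ∈B⇒∈A∉f αd∉f))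
                                 (d ∈? A) (d ∈? B)))

  downFlip-flux : ∀ {f A B} → PerfectMatching G A → DownFlip G f A B → Flux (onFace f) A B
  downFlip-flux A-perfect flip d d-black = downFlip-flux-at A-perfect flip d-black

  flux-refl : ∀ {A} → Flux (λ _ → 0) A A
  flux-refl {A} d _ = +-inverseʳ (+ 𝟙 (d ∈? A))

  flux-trans : ∀ {h k A B C} → Flux h A B → Flux k B C → Flux (λ x → h x + k x) A C
  flux-trans {h} {k} {A} {B} {C} A→B B→C d d-black = begin
    + 𝟙 (d ∈? A) - + 𝟙 (d ∈? C)
      ≡⟨ a-c≡[a-b]+[b-c] (+ 𝟙 (d ∈? A)) (+ 𝟙 (d ∈? B)) (+ 𝟙 (d ∈? C)) ⟩
    (+ 𝟙 (d ∈? A) - + 𝟙 (d ∈? B)) ℤ.+ (+ 𝟙 (d ∈? B) - + 𝟙 (d ∈? C))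
      ≡⟨ cong₂ ℤ._+_ (A→B d d-black) (B→C d d-black) ⟩
    (+ h d - + h (α d)) ℤ.+ (+ k d - + k (α d))
      ≡⟨ [a+b]-[c+d]≡[a-c]+[b-d] (+ h d) (+ k d) (+ h (α d)) (+ k (α d)) ⟨
    (+ h d ℤ.+ + k d) - (+ h (α d) ℤ.+ + k (α d))
      ≡⟨ cong₂ _-_ (pos-+ (h d) (k d)) (pos-+ (h (α d)) (k (α d))) ⟨
    + (h d + k d) - + (h (α d) + k (α d))
      ∎

  flux-resp : ∀ {h k A B} → (∀ x → h x ≡ k x) → Flux h A B → Flux k A B
  flux-resp h≗k A→B d d-black = trans (A→B d d-black) (diff-cong (h≗k d) (h≗k (α d)))

  flips : List (Fin n) → Fin n → ℕ
  flips L x = count (λ f → sameOrbit? f x) L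

  flips-φ : ∀ L x → flips L (φ G x) ≡ flips L x
  flips-φ L x = count-cong _ _ (All.universal (λ _ → mk⇔ sameOrbit-unstep sameOrbit-step) L)

  flips-outer : ∀ {L} → All (BoundedFace G) L → flips L outer ≡ 0
  flips-outer bounded = count-none _ (All.map (λ (_ , outer∉f) → outer∉f ∘ sameOrbit-sym) bounded)

  -- σ = φ ∘ α, and σ, α generate a transitive action by connectedness.
  constant-if-edge-and-face-invariant : ∀ {C : Set} (h : Fin n → C) →
    (∀ d → colour d ≡ true → h (α d) ≡ h d) → (∀ d → h (φ G d) ≡ h d) → ∀ x → h x ≡ h outer
  constant-if-edge-and-face-invariant h black-inv φ-inv x = sym (along (connected outer x))
    where
    α-inv : ∀ d → h (α d) ≡ h d
    α-inv d with colour d in d-colour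
    ... | true  = black-inv d d-colour
    ... | false = sym (trans (cong h (sym (α-invol d))) (black-inv (α d) (trans (colour-α d) (cong not d-colour))))

    σ-inv : ∀ d → h (σ d) ≡ h d
    σ-inv d = trans (cong (h ∘ σ) (sym (α-invol d))) (trans (φ-inv (α d)) (α-inv d))

    along : ∀ {y z} → Star (λ y z → (z ≡ σ y) ⊎ (z ≡ α y)) y z → h y ≡ h z
    along ε                   = refl
    along {y} (inj₁ refl ◅ s) = trans (sym (σ-inv y)) (along s)
    along {y} (inj₂ refl ◅ s) = trans (sym (α-inv y)) (along s)

  flips-unique : ∀ {L₁ L₂ A B} → All (BoundedFace G) L₁ → All (BoundedFace G) L₂ →
                 Flux (flips L₁) A B → Flux (flips L₂) A B → ∀ x → flips L₁ x ≡ flips L₂ x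
  flips-unique {L₁} {L₂} {A} {B} bounded₁ bounded₂ flux₁ flux₂ x =
    +-injective (i-j≡0⇒i≡j _ _ (trans (constant-if-edge-and-face-invariant D D-α D-φ x) D-outer))
    where
    D : Fin n → ℤ
    D y = + flips L₁ y - + flips L₂ y

    D-α : ∀ d → colour d ≡ true → D (α d) ≡ D d
    D-α d d-black = sym (i-j≡0⇒i≡j _ _ (begin
      D d - D (α d)
        ≡⟨ [a-b]-[c-d]≡[a-c]-[b-d] (+ flips L₁ d) (+ flips L₂ d) (+ flips L₁ (α d)) (+ flips L₂ (α d)) ⟩
      (+ flips L₁ d - + flips L₁ (α d)) - (+ flips L₂ d - + flips L₂ (α d))
        ≡⟨ cong₂ _-_ (flux₁ d d-black) (flux₂ d d-black) ⟨
      (+ 𝟙 (d ∈? A) - + 𝟙 (d ∈? B)) - (+ 𝟙 (d ∈? A) - + 𝟙 (d ∈? B))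
        ≡⟨ +-inverseʳ (+ 𝟙 (d ∈? A) - + 𝟙 (d ∈? B)) ⟩
      + 0
        ∎))

    D-φ : ∀ d → D (φ G d) ≡ D d
    D-φ d = diff-cong (flips-φ L₁ d) (flips-φ L₂ d)

    D-outer : D outer ≡ + 0
    D-outer = diff-cong (flips-outer bounded₁) (flips-outer bounded₂)

  labels : ∀ {A B} → Star (DownStep G) A B → List (Fin n)
  labels ε                     = []
  labels ((_ , _ , f , _) ◅ p) = f ∷ labels p

  labels-bounded : ∀ {A B} (p : Star (DownStep G) A B) → All (BoundedFace G) (labels p)
  labels-bounded ε                                 = []
  labels-bounded ((_ , _ , _ , f-bounded , _) ◅ p) = f-bounded ∷ labels-bounded p

  downPath-flux : ∀ {A B} (p : Star (DownStep G) A B) → Flux (flips (labels p)) A B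
  downPath-flux ε = flux-refl
  downPath-flux ((A-perfect , _ , f , _ , flip) ◅ p) =
    flux-trans {h = onFace f} {k = flips (labels p)} (downFlip-flux A-perfect flip) (downPath-flux p)

  downPath-perfect : ∀ {A B} → Star (DownStep G) A B → PerfectMatching G A → PerfectMatching G B
  downPath-perfect ε                         A-perfect = A-perfect
  downPath-perfect ((_ , C-perfect , _) ◅ p) _         = downPath-perfect p C-perfect

  -- Around a cycle the flip counts equal those of the empty path, yet its first face is flipped.
  downPaths-antisym : ∀ {A B} → Star (DownStep G) A B → Star (DownStep G) B A → A ≡ B
  downPaths-antisym ε _ = refl
  downPaths-antisym (s@(_ , _ , f , _) ◅ p) q =
    contradiction (flips-unique (labels-bounded cycle) [] (downPath-flux cycle) flux-refl f)
      (count-∷≢0 (λ g → sameOrbit? g f) {xs = labels (p ◅◅ q)} (0 , refl))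
    where
    cycle = s ◅ (p ◅◅ q)

  covering-flip-is-down : ∀ {f M₀ M₁} → _⋖D_ G M₀ M₁ → FlipAt G f M₀ M₁ →
                          PerfectMatching G M₁ × DownFlip G f M₁ M₀
  covering-flip-is-down (ε , M₀≢M₁ , _) _ = contradiction refl M₀≢M₁
  covering-flip-is-down ((M₁-perfect , _) ◅ _ , _ , _) (_ , inj₂ down) = M₁-perfect , down
  covering-flip-is-down {f} (s@(M₁-perfect , C-perfect , _) ◅ p , M₀≢M₁ , _) (f-bounded , inj₁ up) =
    contradiction (downPaths-antisym ((M₀-perfect , M₁-perfect , f , f-bounded , up) ◅ ε) (s ◅ p)) M₀≢M₁
    where
    M₀-perfect = downPath-perfect p C-perfect

  satChain-bounded : ∀ {A B ws} → SatChain G A B ws → All (BoundedFace G) ws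
  satChain-bounded done                             = []
  satChain-bounded (step _ _ (f-bounded , _) chain) = f-bounded ∷ satChain-bounded chain

  satChain-flux : ∀ {A B ws} → SatChain G A B ws → Flux (flips ws) B A
  satChain-flux done = flux-refl
  satChain-flux (step {fs = fs} f cover flip chain) with M₁-perfect , down ← covering-flip-is-down cover flip =
    flux-resp (λ x → +-comm (flips fs x) (onFace f x))
      (flux-trans {h = flips fs} {k = onFace f} (satChain-flux chain) (downFlip-flux M₁-perfect down))

  flips-rep : ∀ {L x} → All (BoundedFace G) L → T (isOrbitRep (φ G) x) → flips L x ≡ count (x ≟_) L
  flips-rep {x = x} bounded x-rep =
    count-cong _ _
      (All.map (λ (f-rep , _) → mk⇔ (sym ∘ orbitRep-unique f-rep x-rep) λ { refl → 0 , refl }) bounded)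

  count-nonrep : ∀ {L x} → All (BoundedFace G) L → ¬ T (isOrbitRep (φ G) x) → count (x ≟_) L ≡ 0
  count-nonrep bounded x-nonrep =
    count-none _
      (All.map (λ (f-rep , _) x≡f → x-nonrep (subst (T ∘ isOrbitRep (φ G)) (sym x≡f) f-rep)) bounded)

  flips-determine-labels : ∀ {L₁ L₂} → All (BoundedFace G) L₁ → All (BoundedFace G) L₂ →
                           (∀ x → flips L₁ x ≡ flips L₂ x) → L₁ ↭ L₂
  flips-determine-labels {L₁} {L₂} bounded₁ bounded₂ same-flips = count-≡⇒↭ _≟_ L₁ L₂ same-count
    where
    same-count : ∀ x → count (x ≟_) L₁ ≡ count (x ≟_) L₂
    same-count x with T? (isOrbitRep (φ G) x)
    ... | yes x-rep   = trans (sym (flips-rep bounded₁ x-rep)) (trans (same-flips x) (flips-rep bounded₂ x-rep))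
    ... | no x-nonrep = trans (count-nonrep bounded₁ x-nonrep) (sym (count-nonrep bounded₂ x-nonrep))

  satChain-weight-unique : ∀ {A B ws ws′} → SatChain G A B ws → SatChain G A B ws′ → ws ↭ ws′
  satChain-weight-unique c c′ =
    flips-determine-labels (satChain-bounded c) (satChain-bounded c′)
      (flips-unique (satChain-bounded c) (satChain-bounded c′) (satChain-flux c) (satChain-flux c′))

-- Only the plane-graph structure is used: any two saturated chains with common endpoints have
-- the same weight, whether or not property (*) holds or the chains start at 0̂.
proposition2p8 : (G : BipartitePlaneGraph) → EveryEdgeMatchable G →
    (Z : Subset (BipartitePlaneGraph.n G)) → IsBottom G Z →
    (M : Subset (BipartitePlaneGraph.n G)) → PerfectMatching G M →
    (ws ws′ : List (Fin (BipartitePlaneGraph.n G))) →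
    SatChain G Z M ws → SatChain G Z M ws′ → ws ↭ ws′
proposition2p8 G _ _ _ _ _ _ _ = FlipCounts.satChain-weight-unique G
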